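{- Let $d\ge1$, integers $1\le k_1\le\dots\le k_d$, and $2\le k\le k_1+\dots+k_d$. Then $$\sum_{l=1}^{k-1}\frac{\mathcal K_l}{l(l+1)}=n_{k-1}\,\alpha_{k-1}.$$
   Context: $\mathbb N=\{0,1,\dots\}$, $|\mathbf a|=\sum a_m$. $\mathcal D_l:=\{\mathbf a\in\mathbb N^d:a_m\le k_m\ \forall m,\ 1\le|\mathbf a|\le l\}$, $n_l:=|\mathcal D_l|$, $\mathcal K_l:=\sum_{\mathbf a\in\mathcal D_l}|\mathbf a|$. $\alpha_{k-1}$ is defined by $\frac{n_k}{n_{k-1}}=\alpha_{k-1}\frac{n_k}{n_k}+(1-\alpha_{k-1})\frac{\mathcal K_k}{\mathcal K_{k-1}}$. -}

module Defs where

open import Data.Nat using (ℕ; zero; suc; _≤_; _≤?_)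
open import Data.Nat as ℕ using ()
open import Data.Vec using (Vec; []; _∷_)
open import Data.List using (List; []; _∷_; map; concatMap; filter; length; upTo)
open import Data.Product using (_×_)
open import Relation.Nullary.Decidable using (_×-dec_)
open import Data.Rational using (ℚ; 0ℚ; _÷_; _+_; _/_)
open import Data.Rational as Q using ()
open import Data.Integer using (+_)
open import Relation.Nullary using (yes; no)
open import Data.Nat.ListAction as LA using ()

∣_∣ᵥ : ∀ {d} → Vec ℕ d → ℕ
∣ [] ∣ᵥ = 0
∣ x ∷ xs ∣ᵥ = x ℕ.+ ∣ xs ∣ᵥ

-- all a ∈ ℕ^d with a_m ≤ k_m for every m (each listed exactly once)
box : ∀ {d} → Vec ℕ d → List (Vec ℕ d)
box [] = [] ∷ []
box (k ∷ ks) = concatMap (λ x → map (x ∷_) (box ks)) (upTo (suc k))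

𝒟 : ∀ {d} → Vec ℕ d → ℕ → List (Vec ℕ d)
𝒟 ks l = filter (λ a → (1 ≤? ∣ a ∣ᵥ) ×-dec (∣ a ∣ᵥ ≤? l)) (box ks)

nₗ : ∀ {d} → Vec ℕ d → ℕ → ℕ
nₗ ks l = length (𝒟 ks l)

𝒦 : ∀ {d} → Vec ℕ d → ℕ → ℕ
𝒦 ks l = LA.sum (map ∣_∣ᵥ (𝒟 ks l))

ℕ→ℚ : ℕ → ℚ
ℕ→ℚ n = (+ n) / 1

-- total division on ℚ (p / 0 := 0); only used with nonzero denominators
_÷₀_ : ℚ → ℚ → ℚ
p ÷₀ q with q Q.≟ 0ℚ
... | yes _ = 0ℚ
... | no q≢0 = _÷_ p q {{Q.≢-nonZero q≢0}}

Σ₁ : ℕ → (ℕ → ℚ) → ℚ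
Σ₁ zero f = 0ℚ
Σ₁ (suc m) f = Σ₁ m f + f (suc m)

{-# OPTIONS --safe #-}
-- Let c_j be the number of points a of the box with |a| = j. Then
-- n_l = Σ_{j ≤ l} c_j and 𝒦_l = Σ_{j ≤ l} j c_j, so Abel summation gives
-- k · Σ_{l < k} 𝒦_l / (l (l + 1)) = k n_{k-1} − 𝒦_{k-1}.  Substituting
-- n_k = n_{k-1} + c_k and 𝒦_k = 𝒦_{k-1} + k c_k into the relation defining α
-- and cancelling c_k ≠ 0 (a point with |a| = k exists as k ≤ Σ k_m) gives
-- 𝒦_{k-1} = (1 − α) k n_{k-1}, hence the sum equals α n_{k-1}.
module Submission where

open import Defs
open import Data.Empty using (⊥)
open import Data.Fin as F using ()
open import Data.Integer as ℤ using ()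
import Data.Integer.Properties as ℤₚ
open import Data.List using (List; []; _∷_; map; filter; length)
open import Data.List.Membership.Propositional using (_∈_; lose)
open import Data.List.Membership.Propositional.Properties using (∈-map⁺; ∈-concatMap⁺; ∈-upTo⁺)
open import Data.List.Properties using (filter-accept; filter-reject; filter-none; filter-some)
open import Data.List.Relation.Unary.All using (All; []; _∷_; universal)
open import Data.List.Relation.Unary.All.Properties using (all-filter)
open import Data.List.Relation.Unary.Any using (here)
open import Data.Nat using (ℕ; zero; suc; _≤_; _<_; _∸_; z≤n; s≤s; _≤?_; _≟_)
open import Data.Nat as ℕ using ()
open import Data.Nat.Coprimality as Coprime using ()
open import Data.Nat.ListAction using (sum)
import Data.Nat.Properties as ℕₚ
open import Algebra.Properties.CommutativeSemigroup ℕₚ.+-commutativeSemigroup using (x∙yz≈y∙xz)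
open import Data.Product using (_×_; _,_; ∃-syntax)
open import Data.Rational using (ℚ; 0ℚ; 1ℚ; _+_; _*_; _-_; 1/_; mkℚ)
open import Data.Rational as ℚ using ()
import Data.Rational.Properties as ℚₚ
open import Data.Rational.Solver using (module +-*-Solver)
open import Data.Sum using (_⊎_; inj₁; inj₂; [_,_])
open import Data.Vec using (Vec; []; _∷_; lookup)
open import Function using (_∘_)
open import Function.Bundles using (_⇔_; mk⇔; Equivalence)
open import Relation.Binary.PropositionalEquality
  using (_≡_; _≢_; refl; sym; trans; cong; cong₂; subst; module ≡-Reasoning)
open import Relation.Nullary using (Dec; yes; no)
open import Relation.Nullary.Decidable using (_×-dec_)
open import Relation.Nullary.Negation using (contradiction)
open import Relation.Unary using (Pred; Decidable)

open ≡-Reasoning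

module _ {a p q r} {A : Set a} {P : Pred A p} {Q : Pred A q} {R : Pred A r}
         (P? : Decidable P) (Q? : Decidable Q) (R? : Decidable R)
         (P⇔Q⊎R : ∀ x → P x ⇔ (Q x ⊎ R x)) (Q-R-disjoint : ∀ x → Q x → R x → ⊥)
         (w : A → ℕ) where

  private
    Σw : ∀ {s} {S : Pred A s} → Decidable S → List A → ℕ
    Σw S? ys = sum (map w (filter S? ys))

  sum-map-filter-⊎ : ∀ xs → sum (map w (filter P? xs))
                       ≡ sum (map w (filter Q? xs)) ℕ.+ sum (map w (filter R? xs))
  sum-map-filter-⊎ [] = refl
  sum-map-filter-⊎ (x ∷ xs) = by-cases (Q? x) (R? x)
    where
    ih : Σw P? xs ≡ Σw Q? xs ℕ.+ Σw R? xs
    ih = sum-map-filter-⊎ xs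
    by-cases : Dec (Q x) → Dec (R x) → Σw P? (x ∷ xs) ≡ Σw Q? (x ∷ xs) ℕ.+ Σw R? (x ∷ xs)
    by-cases (yes qx) (yes rx) = contradiction rx (Q-R-disjoint x qx)
    by-cases (yes qx) (no ¬rx) = begin
      Σw P? (x ∷ xs)                    ≡⟨ cong (sum ∘ map w) (filter-accept P? {xs = xs} px) ⟩
      w x ℕ.+ Σw P? xs                  ≡⟨ cong (w x ℕ.+_) ih ⟩
      w x ℕ.+ (Σw Q? xs ℕ.+ Σw R? xs)   ≡⟨ ℕₚ.+-assoc (w x) (Σw Q? xs) (Σw R? xs) ⟨
      (w x ℕ.+ Σw Q? xs) ℕ.+ Σw R? xs   ≡⟨ cong₂ ℕ._+_ (cong (sum ∘ map w) (filter-accept Q? {xs = xs} qx))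
                                                       (cong (sum ∘ map w) (filter-reject R? {xs = xs} ¬rx)) ⟨
      Σw Q? (x ∷ xs) ℕ.+ Σw R? (x ∷ xs) ∎
      where px = Equivalence.from (P⇔Q⊎R x) (inj₁ qx)
    by-cases (no ¬qx) (yes rx) = begin
      Σw P? (x ∷ xs)                    ≡⟨ cong (sum ∘ map w) (filter-accept P? {xs = xs} px) ⟩
      w x ℕ.+ Σw P? xs                  ≡⟨ cong (w x ℕ.+_) ih ⟩
      w x ℕ.+ (Σw Q? xs ℕ.+ Σw R? xs)   ≡⟨ x∙yz≈y∙xz (w x) (Σw Q? xs) (Σw R? xs) ⟩
      Σw Q? xs ℕ.+ (w x ℕ.+ Σw R? xs)   ≡⟨ cong₂ ℕ._+_ (cong (sum ∘ map w) (filter-reject Q? {xs = xs} ¬qx))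
                                                       (cong (sum ∘ map w) (filter-accept R? {xs = xs} rx)) ⟨
      Σw Q? (x ∷ xs) ℕ.+ Σw R? (x ∷ xs) ∎
      where px = Equivalence.from (P⇔Q⊎R x) (inj₂ rx)
    by-cases (no ¬qx) (no ¬rx) = begin
      Σw P? (x ∷ xs)                    ≡⟨ cong (sum ∘ map w) (filter-reject P? {xs = xs} ¬px) ⟩
      Σw P? xs                          ≡⟨ ih ⟩
      Σw Q? xs ℕ.+ Σw R? xs             ≡⟨ cong₂ ℕ._+_ (cong (sum ∘ map w) (filter-reject Q? {xs = xs} ¬qx))
                                                       (cong (sum ∘ map w) (filter-reject R? {xs = xs} ¬rx)) ⟨
      Σw Q? (x ∷ xs) ℕ.+ Σw R? (x ∷ xs) ∎
      where ¬px = λ px → [ ¬qx , ¬rx ] (Equivalence.to (P⇔Q⊎R x) px)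

sum-map-constant : ∀ {a} {A : Set a} {w : A → ℕ} {c} {xs : List A}
                   → All (λ x → w x ≡ c) xs → sum (map w xs) ≡ c ℕ.* length xs
sum-map-constant {c = c} [] = sym (ℕₚ.*-zeroʳ c)
sum-map-constant {w = w} {c} {x ∷ xs} (wx≡c ∷ all) = begin
  w x ℕ.+ sum (map w xs)  ≡⟨ cong₂ ℕ._+_ wx≡c (sum-map-constant all) ⟩
  c ℕ.+ c ℕ.* length xs   ≡⟨ ℕₚ.*-suc c (length xs) ⟨
  c ℕ.* suc (length xs)   ∎

length≡sum-map-1 : ∀ {a} {A : Set a} (xs : List A) → length xs ≡ sum (map (λ _ → 1) xs)
length≡sum-map-1 xs =
  sym (trans (sum-map-constant (universal (λ _ → refl) xs)) (ℕₚ.*-identityˡ (length xs)))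

[1,1+l]⇔[1,l]⊎1+l : ∀ l x → (1 ≤ x × x ≤ suc l) ⇔ ((1 ≤ x × x ≤ l) ⊎ x ≡ suc l)
[1,1+l]⇔[1,l]⊎1+l l x = mk⇔ to from
  where
  to : 1 ≤ x × x ≤ suc l → (1 ≤ x × x ≤ l) ⊎ x ≡ suc l
  to (1≤x , x≤1+l) with ℕₚ.m≤n⇒m<n∨m≡n x≤1+l
  ... | inj₁ x<1+l = inj₁ (1≤x , ℕ.s≤s⁻¹ x<1+l)
  ... | inj₂ x≡1+l = inj₂ x≡1+l
  from : (1 ≤ x × x ≤ l) ⊎ x ≡ suc l → 1 ≤ x × x ≤ suc l
  from (inj₁ (1≤x , x≤l)) = 1≤x , ℕₚ.m≤n⇒m≤1+n x≤l
  from (inj₂ refl)        = s≤s z≤n , ℕₚ.≤-refl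

layer : ∀ {d} → Vec ℕ d → ℕ → List (Vec ℕ d)
layer ks j = filter (λ a → ∣ a ∣ᵥ ≟ j) (box ks)

∣layer∣ : ∀ {d} → Vec ℕ d → ℕ → ℕ
∣layer∣ ks j = length (layer ks j)

module _ {d} (ks : Vec ℕ d) where

  sum-map-𝒟-suc : ∀ (w : Vec ℕ d → ℕ) l
    → sum (map w (𝒟 ks (suc l))) ≡ sum (map w (𝒟 ks l)) ℕ.+ sum (map w (layer ks (suc l)))
  sum-map-𝒟-suc w l =
    sum-map-filter-⊎ (λ a → (1 ≤? ∣ a ∣ᵥ) ×-dec (∣ a ∣ᵥ ≤? suc l))
                     (λ a → (1 ≤? ∣ a ∣ᵥ) ×-dec (∣ a ∣ᵥ ≤? l))
                     (λ a → ∣ a ∣ᵥ ≟ suc l)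
                     (λ a → [1,1+l]⇔[1,l]⊎1+l l ∣ a ∣ᵥ)
                     (λ { a (_ , ∣a∣≤l) ∣a∣≡1+l → ℕₚ.1+n≰n (subst (_≤ l) ∣a∣≡1+l ∣a∣≤l) })
                     w (box ks)

  nₗ-suc : ∀ l → nₗ ks (suc l) ≡ nₗ ks l ℕ.+ ∣layer∣ ks (suc l)
  nₗ-suc l = begin
    nₗ ks (suc l)                                          ≡⟨ length≡sum-map-1 (𝒟 ks (suc l)) ⟩
    sum (map one (𝒟 ks (suc l)))                          ≡⟨ sum-map-𝒟-suc one l ⟩
    sum (map one (𝒟 ks l)) ℕ.+ sum (map one (layer ks (suc l)))
      ≡⟨ sym (cong₂ ℕ._+_ (length≡sum-map-1 (𝒟 ks l)) (length≡sum-map-1 (layer ks (suc l)))) ⟩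
    nₗ ks l ℕ.+ ∣layer∣ ks (suc l)                        ∎
    where one : Vec ℕ d → ℕ
          one _ = 1

  𝒦-suc : ∀ l → 𝒦 ks (suc l) ≡ 𝒦 ks l ℕ.+ suc l ℕ.* ∣layer∣ ks (suc l)
  𝒦-suc l = trans (sum-map-𝒟-suc ∣_∣ᵥ l)
    (cong (𝒦 ks l ℕ.+_) (sum-map-constant (all-filter (λ a → ∣ a ∣ᵥ ≟ suc l) (box ks))))

  𝒟-zero : 𝒟 ks 0 ≡ []
  𝒟-zero = filter-none _
    (universal (λ _ (1≤∣a∣ , ∣a∣≤0) → ℕₚ.1+n≰n (ℕₚ.≤-trans 1≤∣a∣ ∣a∣≤0)) (box ks))

  nₗ-zero : nₗ ks 0 ≡ 0
  nₗ-zero = cong length 𝒟-zero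

  𝒦-zero : 𝒦 ks 0 ≡ 0
  𝒦-zero = cong (λ D → sum (map ∣_∣ᵥ D)) 𝒟-zero

∷-∈-box : ∀ {d x k} {ks as : Vec ℕ d} → x ≤ k → as ∈ box ks → (x ∷ as) ∈ box (k ∷ ks)
∷-∈-box {x = x} x≤k as∈box =
  ∈-concatMap⁺ _ (lose (∈-upTo⁺ (s≤s x≤k)) (∈-map⁺ (x ∷_) as∈box))

box-point-of-size : ∀ {d} (ks : Vec ℕ d) j → j ≤ ∣ ks ∣ᵥ → ∃[ a ] (a ∈ box ks × ∣ a ∣ᵥ ≡ j)
box-point-of-size [] zero _ = [] , here refl , refl
box-point-of-size (k ∷ ks) j j≤ with j ≤? k
... | yes j≤k =
  let as , as∈box , ∣as∣≡0 = box-point-of-size ks 0 z≤n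
  in j ∷ as , ∷-∈-box {ks = ks} j≤k as∈box , trans (cong (j ℕ.+_) ∣as∣≡0) (ℕₚ.+-identityʳ j)
... | no j≰k =
  let as , as∈box , ∣as∣≡j∸k = box-point-of-size ks (j ∸ k) (ℕₚ.m≤n+o⇒m∸n≤o j k j≤)
  in k ∷ as , ∷-∈-box {ks = ks} ℕₚ.≤-refl as∈box
            , trans (cong (k ℕ.+_) ∣as∣≡j∸k) (ℕₚ.m+[n∸m]≡n (ℕₚ.≰⇒≥ j≰k))

module _ {d} (ks : Vec ℕ d) where

  ∣layer∣-pos : ∀ {j} → j ≤ ∣ ks ∣ᵥ → 0 < ∣layer∣ ks j
  ∣layer∣-pos {j} j≤ =
    let a , a∈box , ∣a∣≡j = box-point-of-size ks j j≤
    in filter-some (λ a → ∣ a ∣ᵥ ≟ j) (lose a∈box ∣a∣≡j)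

  nₗ-pos : ∀ {l} → suc l ≤ ∣ ks ∣ᵥ → 0 < nₗ ks (suc l)
  nₗ-pos {l} le = ℕₚ.<-≤-trans (∣layer∣-pos le)
    (subst (∣layer∣ ks (suc l) ≤_) (sym (nₗ-suc ks l)) (ℕₚ.m≤n+m _ _))

  𝒦-pos : ∀ {l} → suc l ≤ ∣ ks ∣ᵥ → 0 < 𝒦 ks (suc l)
  𝒦-pos {l} le = ℕₚ.<-≤-trans (∣layer∣-pos le)
    (subst (∣layer∣ ks (suc l) ≤_) (sym (𝒦-suc ks l))
      (ℕₚ.≤-trans (ℕₚ.m≤n*m (∣layer∣ ks (suc l)) (suc l)) (ℕₚ.m≤n+m _ (𝒦 ks l))))

ℕ→ℚ≡mkℚ : ∀ n → ℕ→ℚ n ≡ mkℚ (ℤ.+ n) 0 (Coprime.sym (Coprime.1-coprimeTo n))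
ℕ→ℚ≡mkℚ n = ℚₚ.normalize-coprime (Coprime.sym (Coprime.1-coprimeTo n))

ℕ→ℚ-homo-+ : ∀ m n → ℕ→ℚ (m ℕ.+ n) ≡ ℕ→ℚ m + ℕ→ℚ n
ℕ→ℚ-homo-+ m n rewrite ℕ→ℚ≡mkℚ m | ℕ→ℚ≡mkℚ n
                     | ℤₚ.*-identityʳ (ℤ.+ m) | ℤₚ.*-identityʳ (ℤ.+ n) = refl

ℕ→ℚ-homo-* : ∀ m n → ℕ→ℚ (m ℕ.* n) ≡ ℕ→ℚ m * ℕ→ℚ n
ℕ→ℚ-homo-* m n rewrite ℕ→ℚ≡mkℚ m | ℕ→ℚ≡mkℚ n | sym (ℤₚ.pos-* m n) = refl

ℕ→ℚ-≢0 : ∀ n → 0 < n → ℕ→ℚ n ≢ 0ℚ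
ℕ→ℚ-≢0 (suc n) _ eq = ℕₚ.1+n≢0 (ℤₚ.+-injective (cong ℚ.↥_ (trans (sym (ℕ→ℚ≡mkℚ (suc n))) eq)))

*-cancelʳ-≡ : ∀ {x y c : ℚ} → c ≢ 0ℚ → x * c ≡ y * c → x ≡ y
*-cancelʳ-≡ {x} {y} {c} c≢0 eq = begin
  x                ≡⟨ sym (ℚₚ.*-identityʳ x) ⟩
  x * 1ℚ           ≡⟨ cong (x *_) (sym (ℚₚ.*-inverseʳ c)) ⟩
  x * (c * 1/ c)   ≡⟨ sym (ℚₚ.*-assoc x c (1/ c)) ⟩
  (x * c) * 1/ c   ≡⟨ cong (_* 1/ c) eq ⟩
  (y * c) * 1/ c   ≡⟨ ℚₚ.*-assoc y c (1/ c) ⟩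
  y * (c * 1/ c)   ≡⟨ cong (y *_) (ℚₚ.*-inverseʳ c) ⟩
  y * 1ℚ           ≡⟨ ℚₚ.*-identityʳ y ⟩
  y                ∎
  where instance _ = ℚ.≢-nonZero c≢0

÷₀-*-cancel : ∀ x {y} → y ≢ 0ℚ → (x ÷₀ y) * y ≡ x
÷₀-*-cancel x {y} y≢0 with y ℚ.≟ 0ℚ
... | yes y≡0 = contradiction y≡0 y≢0
... | no y≢0′ = begin
  (x * 1/ y) * y   ≡⟨ ℚₚ.*-assoc x (1/ y) y ⟩
  x * (1/ y * y)   ≡⟨ cong (x *_) (ℚₚ.*-inverseˡ y) ⟩
  x * 1ℚ           ≡⟨ ℚₚ.*-identityʳ x ⟩
  x                ∎
  where instance _ = ℚ.≢-nonZero y≢0′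

÷₀-self : ∀ {x} → x ≢ 0ℚ → x ÷₀ x ≡ 1ℚ
÷₀-self {x} x≢0 = *-cancelʳ-≡ x≢0 (trans (÷₀-*-cancel x x≢0) (sym (ℚₚ.*-identityˡ x)))

-- The identity S_{m+1} (a + 1) = N_{m+1} (a + 1) − K_{m+1} multiplied by a, so
-- that both hypotheses enter without division.
abel-step : ∀ (S f a N K C : ℚ) → a ≢ 0ℚ
  → S * a ≡ N * a - K → f * (a * (a + 1ℚ)) ≡ K + a * C
  → (S + f) * (a + 1ℚ) ≡ (N + C) * (a + 1ℚ) - (K + a * C)
abel-step S f a N K C a≢0 IH f-eq = *-cancelʳ-≡ a≢0 (begin
  ((S + f) * (a + 1ℚ)) * a
    ≡⟨ solve 6 (λ S f a N K C → ((S :+ f) :* (a :+ con 1ℚ)) :* a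
                := (S :* a) :* (a :+ con 1ℚ) :+ f :* (a :* (a :+ con 1ℚ))) refl S f a N K C ⟩
  (S * a) * (a + 1ℚ) + f * (a * (a + 1ℚ))
    ≡⟨ cong₂ (λ u v → u * (a + 1ℚ) + v) IH f-eq ⟩
  (N * a - K) * (a + 1ℚ) + (K + a * C)
    ≡⟨ solve 6 (λ S f a N K C → (N :* a :- K) :* (a :+ con 1ℚ) :+ (K :+ a :* C)
                := ((N :+ C) :* (a :+ con 1ℚ) :- (K :+ a :* C)) :* a) refl S f a N K C ⟩
  ((N + C) * (a + 1ℚ) - (K + a * C)) * a ∎)
  where open +-*-Solver

module AbelSummation (N K c : ℕ → ℕ) (N-zero : N 0 ≡ 0) (K-zero : K 0 ≡ 0)
  (N-suc : ∀ l → N (suc l) ≡ N l ℕ.+ c (suc l))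
  (K-suc : ∀ l → K (suc l) ≡ K l ℕ.+ suc l ℕ.* c (suc l)) where

  N-sucℚ : ∀ l → ℕ→ℚ (N (suc l)) ≡ ℕ→ℚ (N l) + ℕ→ℚ (c (suc l))
  N-sucℚ l = trans (cong ℕ→ℚ (N-suc l)) (ℕ→ℚ-homo-+ (N l) (c (suc l)))

  K-sucℚ : ∀ l → ℕ→ℚ (K (suc l)) ≡ ℕ→ℚ (K l) + ℕ→ℚ (suc l) * ℕ→ℚ (c (suc l))
  K-sucℚ l = trans (cong ℕ→ℚ (K-suc l))
    (trans (ℕ→ℚ-homo-+ (K l) _) (cong (ℕ→ℚ (K l) +_) (ℕ→ℚ-homo-* (suc l) (c (suc l)))))

  summand : ℕ → ℚ
  summand l = ℕ→ℚ (K l) ÷₀ ℕ→ℚ (l ℕ.* suc l)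

  abel-summation : ∀ m → Σ₁ m summand * ℕ→ℚ (suc m) ≡ ℕ→ℚ (N m) * ℕ→ℚ (suc m) - ℕ→ℚ (K m)
  abel-summation zero rewrite N-zero | K-zero = refl
  abel-summation (suc m) = begin
    (Σ₁ m summand + summand (suc m)) * ℕ→ℚ (suc (suc m))
      ≡⟨ cong ((Σ₁ m summand + summand (suc m)) *_) 2+m≡ ⟩
    (Σ₁ m summand + summand (suc m)) * (a + 1ℚ)
      ≡⟨ abel-step (Σ₁ m summand) (summand (suc m)) a (ℕ→ℚ (N m)) (ℕ→ℚ (K m)) (ℕ→ℚ (c (suc m)))
           (ℕ→ℚ-≢0 (suc m) (s≤s z≤n)) (abel-summation m) summand-eq ⟩
    (ℕ→ℚ (N m) + ℕ→ℚ (c (suc m))) * (a + 1ℚ) - (ℕ→ℚ (K m) + a * ℕ→ℚ (c (suc m)))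
      ≡⟨ cong₂ (λ u v → u * (a + 1ℚ) - v) (sym (N-sucℚ m)) (sym (K-sucℚ m)) ⟩
    ℕ→ℚ (N (suc m)) * (a + 1ℚ) - ℕ→ℚ (K (suc m))
      ≡⟨ cong (λ u → ℕ→ℚ (N (suc m)) * u - ℕ→ℚ (K (suc m))) (sym 2+m≡) ⟩
    ℕ→ℚ (N (suc m)) * ℕ→ℚ (suc (suc m)) - ℕ→ℚ (K (suc m)) ∎
    where
    a = ℕ→ℚ (suc m)
    2+m≡ : ℕ→ℚ (suc (suc m)) ≡ a + 1ℚ
    2+m≡ = trans (cong ℕ→ℚ (ℕₚ.+-comm 1 (suc m))) (ℕ→ℚ-homo-+ (suc m) 1)
    summand-eq : summand (suc m) * (a * (a + 1ℚ)) ≡ ℕ→ℚ (K m) + a * ℕ→ℚ (c (suc m))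
    summand-eq = begin
      summand (suc m) * (a * (a + 1ℚ))
        ≡⟨ cong (summand (suc m) *_) (sym (trans (ℕ→ℚ-homo-* (suc m) (suc (suc m))) (cong (a *_) 2+m≡))) ⟩
      summand (suc m) * ℕ→ℚ (suc m ℕ.* suc (suc m))
        ≡⟨ ÷₀-*-cancel _ (ℕ→ℚ-≢0 (suc m ℕ.* suc (suc m)) (s≤s z≤n)) ⟩
      ℕ→ℚ (K (suc m))
        ≡⟨ K-sucℚ m ⟩
      ℕ→ℚ (K m) + a * ℕ→ℚ (c (suc m)) ∎

-- With A = (N + C)/N and B = (K + aC)/K, the relation A = α + (1 − α) B
-- becomes C (K − (1 − α) a N) = 0 after clearing denominators.
mixture⇒K≡[1-α]aN : ∀ {α a N K C A B : ℚ} → C ≢ 0ℚ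
  → A * N ≡ N + C → B * K ≡ K + a * C → A ≡ α + (1ℚ - α) * B
  → K ≡ (1ℚ - α) * a * N
mixture⇒K≡[1-α]aN {α} {a} {N} {K} {C} {A} {B} C≢0 A-eq B-eq mixture = *-cancelʳ-≡ C≢0 (begin
  K * C
    ≡⟨ solve 3 (λ N K C → K :* C := (N :+ C) :* K :- N :* K) refl N K C ⟩
  (N + C) * K - N * K
    ≡⟨ cong (λ u → u * K - N * K) (trans (sym A-eq) (cong (_* N) mixture)) ⟩
  ((α + (1ℚ - α) * B) * N) * K - N * K
    ≡⟨ solve 4 (λ α B N K → ((α :+ (con 1ℚ :- α) :* B) :* N) :* K :- N :* K
                := α :* N :* K :+ (con 1ℚ :- α) :* N :* (B :* K) :- N :* K) refl α B N K ⟩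
  α * N * K + (1ℚ - α) * N * (B * K) - N * K
    ≡⟨ cong (λ u → α * N * K + (1ℚ - α) * N * u - N * K) B-eq ⟩
  α * N * K + (1ℚ - α) * N * (K + a * C) - N * K
    ≡⟨ solve 5 (λ α N K a C → α :* N :* K :+ (con 1ℚ :- α) :* N :* (K :+ a :* C) :- N :* K
                := ((con 1ℚ :- α) :* a :* N) :* C) refl α N K a C ⟩
  ((1ℚ - α) * a * N) * C ∎)
  where open +-*-Solver

lemma3p4 : (d : ℕ) → 1 ≤ d → (ks : Vec ℕ d)
    → (∀ i → 1 ≤ lookup ks i)
    → (∀ i j → i F.≤ j → lookup ks i ≤ lookup ks j)
    → (k : ℕ) → 2 ≤ k → k ≤ ∣ ks ∣ᵥ
    → (α : ℚ)
    → ℕ→ℚ (nₗ ks k) ÷₀ ℕ→ℚ (nₗ ks (k ∸ 1))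
        ≡ α * (ℕ→ℚ (nₗ ks k) ÷₀ ℕ→ℚ (nₗ ks k))
          + (1ℚ - α) * (ℕ→ℚ (𝒦 ks k) ÷₀ ℕ→ℚ (𝒦 ks (k ∸ 1)))
    → Σ₁ (k ∸ 1) (λ l → ℕ→ℚ (𝒦 ks l) ÷₀ ℕ→ℚ (l ℕ.* suc l))
        ≡ ℕ→ℚ (nₗ ks (k ∸ 1)) * α
lemma3p4 _ _ ks _ _ (suc (suc m)) (s≤s (s≤s z≤n)) k≤∣ks∣ α ratio =
  *-cancelʳ-≡ (ℕ→ℚ-≢0 (suc (suc m)) (s≤s z≤n)) (begin
  Σ₁ (suc m) summand * k   ≡⟨ abel-summation (suc m) ⟩
  N * k - K                ≡⟨ cong (N * k -_) K≡[1-α]kN ⟩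
  N * k - (1ℚ - α) * k * N ≡⟨ solve 3 (λ α N k → N :* k :- (con 1ℚ :- α) :* k :* N
                                        := N :* α :* k) refl α N k ⟩
  N * α * k                ∎)
  where
  open +-*-Solver
  open AbelSummation (nₗ ks) (𝒦 ks) (∣layer∣ ks) (nₗ-zero ks) (𝒦-zero ks) (nₗ-suc ks) (𝒦-suc ks)
  k N K C A B : ℚ
  k = ℕ→ℚ (suc (suc m))
  N = ℕ→ℚ (nₗ ks (suc m))
  K = ℕ→ℚ (𝒦 ks (suc m))
  C = ℕ→ℚ (∣layer∣ ks (suc (suc m)))
  A = ℕ→ℚ (nₗ ks (suc (suc m))) ÷₀ N
  B = ℕ→ℚ (𝒦 ks (suc (suc m))) ÷₀ K
  k-1≤∣ks∣ : suc m ≤ ∣ ks ∣ᵥ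
  k-1≤∣ks∣ = ℕₚ.≤-trans (ℕₚ.n≤1+n (suc m)) k≤∣ks∣
  K≡[1-α]kN : K ≡ (1ℚ - α) * k * N
  K≡[1-α]kN = mixture⇒K≡[1-α]aN {α} {k} {N} {K} {C} {A} {B} (ℕ→ℚ-≢0 _ (∣layer∣-pos ks k≤∣ks∣))
    (trans (÷₀-*-cancel _ (ℕ→ℚ-≢0 _ (nₗ-pos ks k-1≤∣ks∣))) (N-sucℚ (suc m)))
    (trans (÷₀-*-cancel _ (ℕ→ℚ-≢0 _ (𝒦-pos ks k-1≤∣ks∣))) (K-sucℚ (suc m)))
    (trans ratio (cong (_+ (1ℚ - α) * B) (trans (cong (α *_) (÷₀-self (ℕ→ℚ-≢0 _ (nₗ-pos ks k≤∣ks∣))))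
                                     (ℚₚ.*-identityʳ α))))
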